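{- Let $G$ be a connected graph with at least two vertices, let $b$ be an integer, and let $G'$ be the graph with $V(G') = V(G) \cup \{v' : v \in V(G)\}$ (each $v'$ a new vertex) and $E(G') = E(G) \cup \{\{u,v'\},\{u',v\},\{u',v'\} : \{u,v\} \in E(G)\}$. Then $G'$ has a dominating set of size at most $b$ if and only if $G$ has a total dominating set of size at most $b$.
   Context: A dominating set of a graph $H$ is a set $X\subseteq V(H)$ with $N[X] = V(H)$ (every vertex is in $X$ or adjacent to a vertex of $X$). A total dominating set is a set $X$ with $\bigcup_{v\in X} N(v) = V(H)$ (every vertex, including those in $X$, has a neighbor in $X$). -}

module Defs where

open import Data.Nat using (ℕ; _+_)
open import Data.Bool using (Bool; true; false)
open import Data.Fin using (Fin; splitAt)
open import Data.Fin.Subset using (Subset; _∈_)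
open import Data.Sum using (_⊎_; inj₁; inj₂)
open import Data.Product using (∃; _×_)
open import Relation.Binary.PropositionalEquality using (_≡_)
open import Relation.Nullary using (¬_)

record Graph (n : ℕ) : Set where
  field
    adj   : Fin n → Fin n → Bool
    sym   : ∀ u v → adj u v ≡ adj v u
    irrefl : ∀ v → adj v v ≡ false

open Graph public

Adj : ∀ {n} → Graph n → Fin n → Fin n → Set
Adj G u v = adj G u v ≡ true

data Walk {n : ℕ} (G : Graph n) : Fin n → Fin n → Set where
  here : ∀ {v} → Walk G v v
  step : ∀ {u w v} → Adj G u w → Walk G w v → Walk G u v

Connected : ∀ {n} → Graph n → Set
Connected G = ∀ u v → Walk G u v

IsDominatingSet : ∀ {n} → Graph n → Subset n → Set
IsDominatingSet G X = ∀ v → v ∈ X ⊎ ∃ λ u → u ∈ X × Adj G u v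

IsTotalDominatingSet : ∀ {n} → Graph n → Subset n → Set
IsTotalDominatingSet G X = ∀ v → ∃ λ u → u ∈ X × Adj G u v

-- The graph G' on Fin (n + n): vertices with splitAt n x = inj₁ v are the
-- original vertices v; those with splitAt n x = inj₂ v are the new copies v'.
doubleAdj : ∀ {n} → Graph n → Fin (n + n) → Fin (n + n) → Bool
doubleAdj {n} G x y with splitAt n x | splitAt n y
... | inj₁ u | inj₁ v = adj G u v
... | inj₁ u | inj₂ v = adj G u v
... | inj₂ u | inj₁ v = adj G u v
... | inj₂ u | inj₂ v = adj G u v

double : ∀ {n} → Graph n → Graph (n + n)
double {n} G = record { adj = doubleAdj G ; sym = s ; irrefl = i }
  where
  s : ∀ x y → doubleAdj G x y ≡ doubleAdj G y x
  s x y with splitAt n x | splitAt n y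
  ... | inj₁ u | inj₁ v = sym G u v
  ... | inj₁ u | inj₂ v = sym G u v
  ... | inj₂ u | inj₁ v = sym G u v
  ... | inj₂ u | inj₂ v = sym G u v
  i : ∀ x → doubleAdj G x x ≡ false
  i x with splitAt n x
  ... | inj₁ u = irrefl G u
  ... | inj₂ u = irrefl G u

{-# OPTIONS --safe #-}
module Submission where

-- A total dominating set X of G gives the dominating set X of G': every vertex x of G'
-- is adjacent to whatever X-vertex is adjacent to its base vertex. Conversely, write a
-- dominating set of G' as p ∪ q' with p, q ⊆ V(G). If v ∉ p ∩ q, then v or v' lies
-- outside the set and is dominated by some u or u', so u ∈ p ∪ q is a neighbour of v.
-- Hence p ∪ q plus one chosen neighbour of each v ∈ p ∩ q is total dominating, of size
-- at most ∣p ∪ q∣ + ∣p ∩ q∣ = ∣p∣ + ∣q∣. Connectedness with n ≥ 2 supplies the neighbours.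

open import Defs
open import Data.Nat using (ℕ; _+_; _≥_; zero; suc; s≤s)
open import Data.Fin.Subset using (Subset; ∣_∣; _∈_; _∉_; _∪_; _∩_; ⁅_⁆; ⊥)
open import Data.Product using (∃; _×_; _,_; proj₁; proj₂)
open import Function.Bundles using (_⇔_; mk⇔)
open import Data.Bool using (true; false)
open import Data.Sum using (inj₁; inj₂; [_,_]′)
open import Data.Fin using (Fin; splitAt; _↑ˡ_; _↑ʳ_; punchIn) renaming (zero to fzero; suc to fsuc)
open import Data.Fin.Properties using (splitAt-↑ˡ; splitAt-↑ʳ; punchInᵢ≢i)
open import Data.Fin.Subset.Properties using (x∈p∪q⁺; x∈p∩q⁺; x∈⁅x⁆; ∣⁅x⁆∣≡1; ∣⊥∣≡0; _∈?_)
open import Data.Vec using ([]; _∷_; _++_)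
import Data.Vec as Vec
open import Data.Vec.Properties using (lookup-++ˡ; lookup-++ʳ; lookup-splitAt; []=⇒lookup; lookup⇒[]=)
open import Data.Empty using (⊥-elim)
open import Function using (id; _∘_)
open import Relation.Nullary using (Dec; yes; no)
open import Relation.Binary.PropositionalEquality
  using (_≡_; _≢_; refl; trans; cong; subst; module ≡-Reasoning)
  renaming (sym to ≡-sym)
import Data.Nat as ℕ
import Data.Nat.Properties as ℕ

private
  variable
    m n : ℕ

∣p∪q∣+∣p∩q∣≡∣p∣+∣q∣ : (p q : Subset n) → ∣ p ∪ q ∣ + ∣ p ∩ q ∣ ≡ ∣ p ∣ + ∣ q ∣
∣p∪q∣+∣p∩q∣≡∣p∣+∣q∣ []          []          = refl
∣p∪q∣+∣p∩q∣≡∣p∣+∣q∣ (true ∷ p)  (true ∷ q)  = cong suc (begin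
  ∣ p ∪ q ∣ + suc ∣ p ∩ q ∣ ≡⟨ ℕ.+-suc ∣ p ∪ q ∣ ∣ p ∩ q ∣ ⟩
  suc (∣ p ∪ q ∣ + ∣ p ∩ q ∣) ≡⟨ cong suc (∣p∪q∣+∣p∩q∣≡∣p∣+∣q∣ p q) ⟩
  suc (∣ p ∣ + ∣ q ∣)       ≡⟨ ℕ.+-suc ∣ p ∣ ∣ q ∣ ⟨
  ∣ p ∣ + suc ∣ q ∣         ∎)
  where open ≡-Reasoning
∣p∪q∣+∣p∩q∣≡∣p∣+∣q∣ (true ∷ p)  (false ∷ q) = cong suc (∣p∪q∣+∣p∩q∣≡∣p∣+∣q∣ p q)
∣p∪q∣+∣p∩q∣≡∣p∣+∣q∣ (false ∷ p) (true ∷ q)  =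
  trans (cong suc (∣p∪q∣+∣p∩q∣≡∣p∣+∣q∣ p q)) (≡-sym (ℕ.+-suc ∣ p ∣ ∣ q ∣))
∣p∪q∣+∣p∩q∣≡∣p∣+∣q∣ (false ∷ p) (false ∷ q) = ∣p∪q∣+∣p∩q∣≡∣p∣+∣q∣ p q

∣p∪q∣≤∣p∣+∣q∣ : (p q : Subset n) → ∣ p ∪ q ∣ ℕ.≤ ∣ p ∣ + ∣ q ∣
∣p∪q∣≤∣p∣+∣q∣ p q =
  subst (∣ p ∪ q ∣ ℕ.≤_) (∣p∪q∣+∣p∩q∣≡∣p∣+∣q∣ p q) (ℕ.m≤m+n ∣ p ∪ q ∣ ∣ p ∩ q ∣)

∣p++q∣≡∣p∣+∣q∣ : (p : Subset m) (q : Subset n) → ∣ p ++ q ∣ ≡ ∣ p ∣ + ∣ q ∣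
∣p++q∣≡∣p∣+∣q∣ []          q = refl
∣p++q∣≡∣p∣+∣q∣ (true ∷ p)  q = cong suc (∣p++q∣≡∣p∣+∣q∣ p q)
∣p++q∣≡∣p∣+∣q∣ (false ∷ p) q = ∣p++q∣≡∣p∣+∣q∣ p q

∣p++⊥∣≡∣p∣ : (p : Subset m) → ∣ p ++ ⊥ {n = n} ∣ ≡ ∣ p ∣
∣p++⊥∣≡∣p∣ {n = n} p =
  trans (∣p++q∣≡∣p∣+∣q∣ p ⊥) (trans (cong (∣ p ∣ +_) (∣⊥∣≡0 n)) (ℕ.+-identityʳ ∣ p ∣))

x∈p⇒x↑ˡ∈p++q : (p : Subset m) (q : Subset n) {x : Fin m} → x ∈ p → x ↑ˡ n ∈ p ++ q
x∈p⇒x↑ˡ∈p++q p q {x} x∈p =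
  lookup⇒[]= _ (p ++ q) (trans (lookup-++ˡ p q x) ([]=⇒lookup x∈p))

x↑ˡ∈p++q⇒x∈p : (p : Subset m) (q : Subset n) {x : Fin m} → x ↑ˡ n ∈ p ++ q → x ∈ p
x↑ˡ∈p++q⇒x∈p p q {x} x∈p++q =
  lookup⇒[]= x p (trans (≡-sym (lookup-++ˡ p q x)) ([]=⇒lookup x∈p++q))

m↑ʳx∈p++q⇒x∈q : (p : Subset m) (q : Subset n) {x : Fin n} → m ↑ʳ x ∈ p ++ q → x ∈ q
m↑ʳx∈p++q⇒x∈q {m} p q {x} x∈p++q =
  lookup⇒[]= x q (trans (≡-sym (lookup-++ʳ p q x)) ([]=⇒lookup x∈p++q))

image : (Fin m → Fin n) → Subset m → Subset n
image f []          = ⊥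
image f (true ∷ p)  = ⁅ f fzero ⁆ ∪ image (f ∘ fsuc) p
image f (false ∷ p) = image (f ∘ fsuc) p

∣image∣≤∣p∣ : (f : Fin m → Fin n) (p : Subset m) → ∣ image f p ∣ ℕ.≤ ∣ p ∣
∣image∣≤∣p∣ {n = n} f [] = ℕ.≤-reflexive (∣⊥∣≡0 n)
∣image∣≤∣p∣ f (true ∷ p) = begin
  ∣ ⁅ f fzero ⁆ ∪ image (f ∘ fsuc) p ∣      ≤⟨ ∣p∪q∣≤∣p∣+∣q∣ ⁅ f fzero ⁆ _ ⟩
  ∣ ⁅ f fzero ⁆ ∣ + ∣ image (f ∘ fsuc) p ∣  ≡⟨ cong (_+ ∣ image (f ∘ fsuc) p ∣) (∣⁅x⁆∣≡1 (f fzero)) ⟩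
  suc ∣ image (f ∘ fsuc) p ∣                ≤⟨ s≤s (∣image∣≤∣p∣ (f ∘ fsuc) p) ⟩
  suc ∣ p ∣                                 ∎
  where open ℕ.≤-Reasoning
∣image∣≤∣p∣ f (false ∷ p) = ∣image∣≤∣p∣ (f ∘ fsuc) p

x∈p⇒f[x]∈image : (f : Fin m → Fin n) (p : Subset m) {x : Fin m} → x ∈ p → f x ∈ image f p
x∈p⇒f[x]∈image f (true ∷ p)  Vec.here        = x∈p∪q⁺ (inj₁ (x∈⁅x⁆ (f fzero)))
x∈p⇒f[x]∈image f (true ∷ p)  (Vec.there x∈p) = x∈p∪q⁺ (inj₂ (x∈p⇒f[x]∈image (f ∘ fsuc) p x∈p))
x∈p⇒f[x]∈image f (false ∷ p) (Vec.there x∈p) = x∈p⇒f[x]∈image (f ∘ fsuc) p x∈p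

base : Fin (n + n) → Fin n
base {n} x = [ id , id ]′ (splitAt n x)

base-↑ˡ : (v : Fin n) → base (v ↑ˡ n) ≡ v
base-↑ˡ {n} v = cong [ id , id ]′ (splitAt-↑ˡ n v n)

base-↑ʳ : (v : Fin n) → base (n ↑ʳ v) ≡ v
base-↑ʳ {n} v = cong [ id , id ]′ (splitAt-↑ʳ n n v)

x∈p++q⇒base[x]∈p∪q : (p q : Subset n) {x : Fin (n + n)} → x ∈ p ++ q → base x ∈ p ∪ q
x∈p++q⇒base[x]∈p∪q {n} p q {x} x∈p++q with splitAt n x | lookup-splitAt n p q x
... | inj₁ y | lookup≡ = x∈p∪q⁺ (inj₁ (lookup⇒[]= y p (trans (≡-sym lookup≡) ([]=⇒lookup x∈p++q))))
... | inj₂ y | lookup≡ = x∈p∪q⁺ (inj₂ (lookup⇒[]= y q (trans (≡-sym lookup≡) ([]=⇒lookup x∈p++q))))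

adj-double : (G : Graph n) (x y : Fin (n + n)) → adj (double G) x y ≡ adj G (base x) (base y)
adj-double {n} G x y with splitAt n x | splitAt n y
... | inj₁ _ | inj₁ _ = refl
... | inj₁ _ | inj₂ _ = refl
... | inj₂ _ | inj₁ _ = refl
... | inj₂ _ | inj₂ _ = refl

Adj-double⁺ : (G : Graph n) {x y : Fin (n + n)} → Adj G (base x) (base y) → Adj (double G) x y
Adj-double⁺ G {x} {y} = trans (adj-double G x y)

Adj-double⁻ : (G : Graph n) {x y : Fin (n + n)} → Adj (double G) x y → Adj G (base x) (base y)
Adj-double⁻ G {x} {y} = trans (≡-sym (adj-double G x y))

Adj-sym : (G : Graph n) {u v : Fin n} → Adj G u v → Adj G v u
Adj-sym G {u} {v} = trans (sym G v u)

walk⇒neighbour : (G : Graph n) {u v : Fin n} → Walk G v u → v ≢ u → ∃ λ w → Adj G w v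
walk⇒neighbour G here              v≢v = ⊥-elim (v≢v refl)
walk⇒neighbour G (step {w = w} a _) _  = w , Adj-sym G a

connected⇒neighbour : (G : Graph n) → Connected G → n ≥ 2 → (v : Fin n) → ∃ λ w → Adj G w v
connected⇒neighbour {suc zero}    G _         (s≤s ()) _
connected⇒neighbour {suc (suc _)} G connected _        v =
  walk⇒neighbour G (connected v (punchIn v fzero)) (punchInᵢ≢i v fzero ∘ ≡-sym)

total⇒dominating-double : (G : Graph n) {X : Subset n} (Y : Subset n) →
  IsTotalDominatingSet G X → IsDominatingSet (double G) (X ++ Y)
total⇒dominating-double {n} G {X} Y total x with total (base x)
... | u , u∈X , u~x = inj₂ (u ↑ˡ n , x∈p⇒x↑ˡ∈p++q X Y u∈X ,
  Adj-double⁺ G (subst (λ w → Adj G w (base x)) (≡-sym (base-↑ˡ u)) u~x))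

collapse : (Fin n → Fin n) → Subset n → Subset n → Subset n
collapse f p q = (p ∪ q) ∪ image f (p ∩ q)

∣collapse∣≤∣p++q∣ : (f : Fin n → Fin n) (p q : Subset n) → ∣ collapse f p q ∣ ℕ.≤ ∣ p ++ q ∣
∣collapse∣≤∣p++q∣ f p q = begin
  ∣ (p ∪ q) ∪ image f (p ∩ q) ∣     ≤⟨ ∣p∪q∣≤∣p∣+∣q∣ (p ∪ q) _ ⟩
  ∣ p ∪ q ∣ + ∣ image f (p ∩ q) ∣   ≤⟨ ℕ.+-monoʳ-≤ ∣ p ∪ q ∣ (∣image∣≤∣p∣ f (p ∩ q)) ⟩
  ∣ p ∪ q ∣ + ∣ p ∩ q ∣             ≡⟨ ∣p∪q∣+∣p∩q∣≡∣p∣+∣q∣ p q ⟩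
  ∣ p ∣ + ∣ q ∣                     ≡⟨ ∣p++q∣≡∣p∣+∣q∣ p q ⟨
  ∣ p ++ q ∣                        ∎
  where open ℕ.≤-Reasoning

dominating-double⇒collapse-total : (G : Graph n) (f : Fin n → Fin n) → (∀ v → Adj G (f v) v) →
  (p q : Subset n) → IsDominatingSet (double G) (p ++ q) → IsTotalDominatingSet G (collapse f p q)
dominating-double⇒collapse-total {n} G f f-adj p q dominating v = cover (v ∈? p) (v ∈? q)
  where
  Covered : Set
  Covered = ∃ λ u → u ∈ collapse f p q × Adj G u v

  cover-via-absent : ∀ x → base x ≡ v → x ∉ p ++ q → Covered
  cover-via-absent x refl x∉p++q with dominating x
  ... | inj₁ x∈p++q              = ⊥-elim (x∉p++q x∈p++q)
  ... | inj₂ (u , u∈p++q , u~x) =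
    base u , x∈p∪q⁺ (inj₁ (x∈p++q⇒base[x]∈p∪q p q u∈p++q)) , Adj-double⁻ G u~x

  cover : Dec (v ∈ p) → Dec (v ∈ q) → Covered
  cover _         (no v∉q)  = cover-via-absent (n ↑ʳ v) (base-↑ʳ v) (v∉q ∘ m↑ʳx∈p++q⇒x∈q p q)
  cover (no v∉p)  (yes _)   = cover-via-absent (v ↑ˡ n) (base-↑ˡ v) (v∉p ∘ x↑ˡ∈p++q⇒x∈p p q)
  cover (yes v∈p) (yes v∈q) =
    f v , x∈p∪q⁺ (inj₂ (x∈p⇒f[x]∈image f (p ∩ q) (x∈p∩q⁺ (v∈p , v∈q)))) , f-adj v

-- Opened only now: the prefix +_ of ℤ makes the ℕ sums above ambiguous to parse.
open import Data.Integer using (ℤ; +_; _≤_)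
import Data.Integer as ℤ
import Data.Integer.Properties as ℤ

lemma8p2 : (n : ℕ) → (G : Graph n) → Connected G → n ≥ 2 → (b : ℤ) →
    ((∃ λ (X : Subset (n + n)) → IsDominatingSet (double G) X × (+ ∣ X ∣) ≤ b)
      ⇔ (∃ λ (X : Subset n) → IsTotalDominatingSet G X × (+ ∣ X ∣) ≤ b))
lemma8p2 n G connected n≥2 b = mk⇔ collapse-dominating enlarge-total
  where
  neighbour : (v : Fin n) → ∃ λ w → Adj G w v
  neighbour = connected⇒neighbour G connected n≥2

  collapse-dominating : (∃ λ (X : Subset (n + n)) → IsDominatingSet (double G) X × (+ ∣ X ∣) ≤ b) →
                        (∃ λ (X : Subset n) → IsTotalDominatingSet G X × (+ ∣ X ∣) ≤ b)
  collapse-dominating (D , dominating , ∣D∣≤b) with Vec.splitAt n D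
  ... | p , q , refl =
    collapse (proj₁ ∘ neighbour) p q ,
    dominating-double⇒collapse-total G (proj₁ ∘ neighbour) (proj₂ ∘ neighbour) p q dominating ,
    ℤ.≤-trans (ℤ.+≤+ (∣collapse∣≤∣p++q∣ (proj₁ ∘ neighbour) p q)) ∣D∣≤b

  enlarge-total : (∃ λ (X : Subset n) → IsTotalDominatingSet G X × (+ ∣ X ∣) ≤ b) →
                  (∃ λ (X : Subset (n + n)) → IsDominatingSet (double G) X × (+ ∣ X ∣) ≤ b)
  enlarge-total (X , total , ∣X∣≤b) =
    X ++ ⊥ , total⇒dominating-double G ⊥ total , subst (λ k → + k ≤ b) (≡-sym (∣p++⊥∣≡∣p∣ X)) ∣X∣≤b
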